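{- Let $\mathcal{M}$ be a nonstandard model of $\mathsf{PA}$ with $\mathrm{SSy}(\mathcal{M})=\mathcal{P}(\omega)$, and let $\mathcal{U},\mathcal{V}$ be ultrafilters over $\omega$. Then $\mathcal{U}\leq_{\mathsf{RK}}\mathcal{V}$ iff $\mathcal{U}\leq^{\mathcal{M}}_{\mathsf{RK}}\mathcal{V}$.
   Context: $\mathrm{SSy}(\mathcal{M})=\{X\cap\omega:X$ a parametrically definable subset of $M\}$. For ultrafilters $\mathcal{U},\mathcal{V}$ over $\omega$, $\mathcal{U}\leq_{\mathsf{RK}}\mathcal{V}$ (Rudin–Keisler) means there is $f:\omega\to\omega$ with $f^{ -1}(A)\in\mathcal{V}$ for every $A\in\mathcal{U}$. For ultrafilters of $\mathrm{SSy}(\mathcal{M})$, $\mathcal{U}\leq^{\mathcal{M}}_{\mathsf{RK}}\mathcal{V}$ means there is an $\mathcal{M}$-definable $t:M\to M$ such that whenever $X$ is a parametrically definable subset of $M$ with $X\cap\omega\in\mathcal{U}$, then $t^{ -1}(X)\cap\omega\in\mathcal{V}$. -}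

module Defs where

open import Level using (0ℓ)
open import Data.Nat as ℕ using (ℕ)
open import Data.Fin using (Fin)
open import Data.Product using (Σ; Σ-syntax; ∃; _×_; _,_)
open import Data.Sum using (_⊎_)
open import Data.Unit using (⊤)
open import Data.Empty using (⊥)
open import Relation.Nullary using (¬_)
open import Relation.Unary using (Pred)
open import Relation.Binary.PropositionalEquality using (_≡_; _≢_)
open import Function.Bundles using (_⇔_)

-- First-order language of arithmetic {0, S, +, ·, =}
-- Terms / formulas with n free variables (de Bruijn, Fin n).

data Term (n : ℕ) : Set where
  var  : Fin n → Term n
  `0   : Term n
  `S   : Term n → Term n
  _`+_ : Term n → Term n → Term n
  _`*_ : Term n → Term n → Term n

data Formula (n : ℕ) : Set where
  _`=_  : Term n → Term n → Formula n
  `⊥    : Formula n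
  _`∧_  : Formula n → Formula n → Formula n
  _`∨_  : Formula n → Formula n → Formula n
  _`⇒_  : Formula n → Formula n → Formula n
  `∀    : Formula (ℕ.suc n) → Formula n
  `∃    : Formula (ℕ.suc n) → Formula n

record Structure : Set₁ where
  field
    Carrier : Set
    z       : Carrier
    s       : Carrier → Carrier
    _⊕_     : Carrier → Carrier → Carrier
    _⊗_     : Carrier → Carrier → Carrier

module _ (M : Structure) where
  open Structure M

  Env : ℕ → Set
  Env n = Fin n → Carrier

  extend : ∀ {n} → Carrier → Env n → Env (ℕ.suc n)
  extend a ρ Fin.zero    = a
  extend a ρ (Fin.suc i) = ρ i

  ⟦_⟧t : ∀ {n} → Term n → Env n → Carrier
  ⟦ var i ⟧t   ρ = ρ i
  ⟦ `0 ⟧t      ρ = z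
  ⟦ `S t ⟧t    ρ = s (⟦ t ⟧t ρ)
  ⟦ t `+ u ⟧t  ρ = ⟦ t ⟧t ρ ⊕ ⟦ u ⟧t ρ
  ⟦ t `* u ⟧t  ρ = ⟦ t ⟧t ρ ⊗ ⟦ u ⟧t ρ

  Sat : ∀ {n} → Formula n → Env n → Set
  Sat (t `= u)  ρ = ⟦ t ⟧t ρ ≡ ⟦ u ⟧t ρ
  Sat `⊥        ρ = ⊥
  Sat (φ `∧ ψ)  ρ = Sat φ ρ × Sat ψ ρ
  Sat (φ `∨ ψ)  ρ = Sat φ ρ ⊎ Sat ψ ρ
  Sat (φ `⇒ ψ)  ρ = Sat φ ρ → Sat ψ ρ
  Sat (`∀ φ)    ρ = (a : Carrier) → Sat φ (extend a ρ)
  Sat (`∃ φ)    ρ = Σ[ a ∈ Carrier ] Sat φ (extend a ρ)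

  num : ℕ → Carrier
  num ℕ.zero    = z
  num (ℕ.suc k) = s (num k)

  Definable : Pred Carrier 0ℓ → Set
  Definable X = Σ[ n ∈ ℕ ] Σ[ φ ∈ Formula (ℕ.suc n) ] Σ[ ρ ∈ Env n ]
                  ((x : Carrier) → X x ⇔ Sat φ (extend x ρ))

  DefinableFun : (Carrier → Carrier) → Set
  DefinableFun t = Σ[ n ∈ ℕ ] Σ[ ψ ∈ Formula (ℕ.suc (ℕ.suc n)) ] Σ[ ρ ∈ Env n ]
                  ((x y : Carrier) → (t x ≡ y) ⇔ Sat ψ (extend x (extend y ρ)))

  _∩ω : Pred Carrier 0ℓ → Pred ℕ 0ℓ
  (X ∩ω) k = X (num k)

  SSy : Pred ℕ 0ℓ → Set₁
  SSy A = Σ[ X ∈ Pred Carrier 0ℓ ] Definable X × ((k : ℕ) → A k ⇔ (X ∩ω) k)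

  SSy≡Pω : Set₁
  SSy≡Pω = (A : Pred ℕ 0ℓ) → SSy A

  Nonstandard : Set
  Nonstandard = Σ[ a ∈ Carrier ] ((k : ℕ) → a ≢ num k)

  record IsPA : Set₁ where
    field
      s≢z    : (x : Carrier) → s x ≢ z
      s-inj  : (x y : Carrier) → s x ≡ s y → x ≡ y
      ⊕-z    : (x : Carrier) → x ⊕ z ≡ x
      ⊕-s    : (x y : Carrier) → x ⊕ s y ≡ s (x ⊕ y)
      ⊗-z    : (x : Carrier) → x ⊗ z ≡ z
      ⊗-s    : (x y : Carrier) → x ⊗ s y ≡ (x ⊗ y) ⊕ x
      ind    : ∀ {n} (φ : Formula (ℕ.suc n)) (ρ : Env n) →
               Sat φ (extend z ρ) →
               ((x : Carrier) → Sat φ (extend x ρ) → Sat φ (extend (s x) ρ)) →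
               (x : Carrier) → Sat φ (extend x ρ)

record IsUltrafilter (𝒰 : Pred (Pred ℕ 0ℓ) 0ℓ) : Set₁ where
  field
    full   : 𝒰 (λ _ → ⊤)
    proper : ¬ 𝒰 (λ _ → ⊥)
    up     : (A B : Pred ℕ 0ℓ) → ((k : ℕ) → A k → B k) → 𝒰 A → 𝒰 B
    inter  : (A B : Pred ℕ 0ℓ) → 𝒰 A → 𝒰 B → 𝒰 (λ k → A k × B k)
    ultra  : (A : Pred ℕ 0ℓ) → 𝒰 A ⊎ 𝒰 (λ k → ¬ A k)

_≤RK_ : Pred (Pred ℕ 0ℓ) 0ℓ → Pred (Pred ℕ 0ℓ) 0ℓ → Set₁
𝒰 ≤RK 𝒱 = Σ[ f ∈ (ℕ → ℕ) ] ((A : Pred ℕ 0ℓ) → 𝒰 A → 𝒱 (λ k → A (f k)))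

_≤RK[_]_ : Pred (Pred ℕ 0ℓ) 0ℓ → (M : Structure) → Pred (Pred ℕ 0ℓ) 0ℓ → Set₁
𝒰 ≤RK[ M ] 𝒱 = Σ[ t ∈ (Carrier → Carrier) ] DefinableFun M t ×
    ((X : Pred Carrier 0ℓ) → Definable M X →
       𝒰 (_∩ω M X) → 𝒱 (_∩ω M (λ x → X (t x))))
  where open Structure M

{-# OPTIONS --safe #-}

-- Since SSy(M) = P(ω), the codes ⟨a , m⟩ with m ≤ f a are the trace on ω of a definable
-- set K; sending x to the y with ⟨x , m⟩ ∈ K for all m ≤ y but ⟨x , y + 1⟩ ∉ K (and to 0
-- when there is no unique such y) is a definable t : M → M extending f.
-- Conversely, a definable t witnessing 𝒰 ≤RK[ M ] 𝒱 takes standard values on a 𝒱-large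
-- set of numerals, and reading these values off gives f with 𝒰 ≤RK 𝒱.
module Submission where

open import Defs
open import Level using (0ℓ)
open import Data.Nat using (ℕ)
open import Relation.Unary using (Pred)
open import Function.Bundles using (_⇔_)
open import Axiom.ExcludedMiddle using (ExcludedMiddle)

open import Data.Nat using (zero; suc; _+_; _*_; _≤_; _<_)
open import Data.Nat.Properties
open import Data.Fin using (Fin; _↑ˡ_; _↑ʳ_) renaming (zero to fz; suc to fs)
open import Data.Vec.Functional using ([]; _∷_; _++_)
open import Data.Vec.Functional.Properties using (lookup-++ˡ; lookup-++ʳ)
open import Data.Product using (Σ-syntax; _×_; _,_; proj₁; proj₂)
open import Data.Product.Function.NonDependent.Propositional using (_×-⇔_)
import Data.Product.Function.Dependent.Propositional as Σ
open import Data.Sum using (_⊎_; inj₁; inj₂)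
open import Data.Sum.Function.Propositional using (_⊎-⇔_)
open import Data.Empty using (⊥; ⊥-elim)
open import Function using (_∘_)
open import Function.Bundles using (Equivalence; mk⇔)
open import Function.Properties.Equivalence using () renaming (refl to ⇔-refl; sym to ⇔-sym; trans to ⇔-trans)
open import Function.Related.Propositional using (equivalence)
open import Function.Related.TypeIsomorphisms using (→-cong-⇔; ¬-cong-⇔)
open import Relation.Nullary using (¬_; Dec; yes; no)
open import Relation.Binary.PropositionalEquality
open import Relation.Binary using (tri<; tri≈; tri>)

open Equivalence using (to; from)
open IsUltrafilter using (full; proper; up; inter; ultra)

private variable n m : ℕ

renameTerm : (Fin n → Fin m) → Term n → Term m
renameTerm r (var i)  = var (r i)
renameTerm r `0       = `0
renameTerm r (`S u)   = `S (renameTerm r u)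
renameTerm r (u `+ v) = renameTerm r u `+ renameTerm r v
renameTerm r (u `* v) = renameTerm r u `* renameTerm r v

weaken : Term n → Term (suc n)
weaken = renameTerm fs

substTerm : (Fin n → Term m) → Term n → Term m
substTerm σ (var i)  = σ i
substTerm σ `0       = `0
substTerm σ (`S u)   = `S (substTerm σ u)
substTerm σ (u `+ v) = substTerm σ u `+ substTerm σ v
substTerm σ (u `* v) = substTerm σ u `* substTerm σ v

liftSubst : (Fin n → Term m) → Fin (suc n) → Term (suc m)
liftSubst σ = var fz ∷ weaken ∘ σ

substFormula : (Fin n → Term m) → Formula n → Formula m
substFormula σ (u `= v) = substTerm σ u `= substTerm σ v
substFormula σ `⊥       = `⊥
substFormula σ (φ `∧ ψ) = substFormula σ φ `∧ substFormula σ ψ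
substFormula σ (φ `∨ ψ) = substFormula σ φ `∨ substFormula σ ψ
substFormula σ (φ `⇒ ψ) = substFormula σ φ `⇒ substFormula σ ψ
substFormula σ (`∀ φ)   = `∀ (substFormula (liftSubst σ) φ)
substFormula σ (`∃ φ)   = `∃ (substFormula (liftSubst σ) φ)

instantiate : Formula (suc n) → Term m → (Fin n → Fin m) → Formula m
instantiate φ u r = substFormula (u ∷ var ∘ r) φ

instantiate₂ : Formula (suc (suc n)) → Term m → Term m → (Fin n → Fin m) → Formula m
instantiate₂ φ u v r = substFormula (u ∷ v ∷ var ∘ r) φ

`¬_ : Formula n → Formula n
`¬ φ = φ `⇒ `⊥

_`≤_ _`<_ : Term n → Term n → Formula n
u `≤ v = `∃ ((weaken u `+ var fz) `= weaken v)
u `< v = `∃ ((weaken u `+ `S (var fz)) `= weaken v)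

pairᵗ : Term n → Term n → Term n
pairᵗ u v = ((u `+ v) `* (u `+ v)) `+ u

pair : ℕ → ℕ → ℕ
pair a b = (a + b) * (a + b) + a

pair-< : ∀ a b a′ b′ → a + b < a′ + b′ → pair a b < pair a′ b′
pair-< a b a′ b′ lt = begin-strict
  p * p + a         ≤⟨ +-monoʳ-≤ (p * p) (m≤m+n a b) ⟩
  p * p + p         ≡⟨ +-comm (p * p) p ⟩
  p + p * p         ≤⟨ m≤n+m (p + p * p) p ⟩
  p + (p + p * p)   ≡⟨ cong (p +_) (sym (*-suc p p)) ⟩
  p + p * suc p     <⟨ n<1+n _ ⟩
  suc p * suc p     ≤⟨ *-mono-≤ lt lt ⟩
  q * q             ≤⟨ m≤m+n (q * q) a′ ⟩
  q * q + a′        ∎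
  where
  open ≤-Reasoning
  p = a + b
  q = a′ + b′

pair-injective : ∀ a b a′ b′ → pair a b ≡ pair a′ b′ → a ≡ a′ × b ≡ b′
pair-injective a b a′ b′ eq with <-cmp (a + b) (a′ + b′)
... | tri< lt _ _ = ⊥-elim (<-irrefl eq (pair-< a b a′ b′ lt))
... | tri> _ _ gt = ⊥-elim (<-irrefl (sym eq) (pair-< a′ b′ a b gt))
... | tri≈ _ sum≡ _ = a≡a′ , +-cancelˡ-≡ a b b′ (trans sum≡ (cong (_+ b′) (sym a≡a′)))
  where
  a≡a′ : a ≡ a′
  a≡a′ = +-cancelˡ-≡ ((a + b) * (a + b)) a a′ (trans eq (cong (λ p → p * p + a′) (sym sum≡)))

UnderGraph : (ℕ → ℕ) → Pred ℕ 0ℓ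
UnderGraph f n = Σ[ a ∈ ℕ ] Σ[ b ∈ ℕ ] n ≡ pair a b × b ≤ f a

UnderGraph-pair : ∀ f {a b} → UnderGraph f (pair a b) ⇔ b ≤ f a
UnderGraph-pair f {a} {b} = mk⇔ to′ (λ b≤fa → a , b , refl , b≤fa)
  where
  to′ : UnderGraph f (pair a b) → b ≤ f a
  to′ (a′ , b′ , eq , b′≤fa′) with pair-injective a b a′ b′ eq
  ... | refl , refl = b′≤fa′

module Model (M : Structure) where
  open Structure M

  ⟦_⟧ : Term n → Env M n → Carrier
  ⟦_⟧ = ⟦_⟧t M

  infixr 5 _∷ᴱ_
  _∷ᴱ_ : Carrier → Env M n → Env M (suc n)
  _∷ᴱ_ = extend M

  ⌜_⌝ : ℕ → Carrier
  ⌜_⌝ = num M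

  ⟦renameTerm⟧ : (r : Fin n → Fin m) (u : Term n) (ρ : Env M m) →
                 ⟦ renameTerm r u ⟧ ρ ≡ ⟦ u ⟧ (ρ ∘ r)
  ⟦renameTerm⟧ r (var i)  ρ = refl
  ⟦renameTerm⟧ r `0       ρ = refl
  ⟦renameTerm⟧ r (`S u)   ρ = cong s (⟦renameTerm⟧ r u ρ)
  ⟦renameTerm⟧ r (u `+ v) ρ = cong₂ _⊕_ (⟦renameTerm⟧ r u ρ) (⟦renameTerm⟧ r v ρ)
  ⟦renameTerm⟧ r (u `* v) ρ = cong₂ _⊗_ (⟦renameTerm⟧ r u ρ) (⟦renameTerm⟧ r v ρ)

  ⟦substTerm⟧ : (σ : Fin n → Term m) (u : Term n) {ρ : Env M m} {τ : Env M n} →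
                (λ i → ⟦ σ i ⟧ ρ) ≗ τ → ⟦ substTerm σ u ⟧ ρ ≡ ⟦ u ⟧ τ
  ⟦substTerm⟧ σ (var i)  σ≗τ = σ≗τ i
  ⟦substTerm⟧ σ `0       σ≗τ = refl
  ⟦substTerm⟧ σ (`S u)   σ≗τ = cong s (⟦substTerm⟧ σ u σ≗τ)
  ⟦substTerm⟧ σ (u `+ v) σ≗τ = cong₂ _⊕_ (⟦substTerm⟧ σ u σ≗τ) (⟦substTerm⟧ σ v σ≗τ)
  ⟦substTerm⟧ σ (u `* v) σ≗τ = cong₂ _⊗_ (⟦substTerm⟧ σ u σ≗τ) (⟦substTerm⟧ σ v σ≗τ)

  ⟦liftSubst⟧ : (σ : Fin n → Term m) {ρ : Env M m} {τ : Env M n} →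
                (λ i → ⟦ σ i ⟧ ρ) ≗ τ →
                ∀ a → (λ i → ⟦ liftSubst σ i ⟧ (a ∷ᴱ ρ)) ≗ a ∷ᴱ τ
  ⟦liftSubst⟧ σ σ≗τ a fz     = refl
  ⟦liftSubst⟧ σ σ≗τ a (fs i) = trans (⟦renameTerm⟧ fs (σ i) _) (σ≗τ i)

  Sat-substFormula : (σ : Fin n → Term m) (φ : Formula n) {ρ : Env M m} {τ : Env M n} →
                     (λ i → ⟦ σ i ⟧ ρ) ≗ τ → Sat M (substFormula σ φ) ρ ⇔ Sat M φ τ
  Sat-substFormula σ (u `= v) σ≗τ
    rewrite ⟦substTerm⟧ σ u σ≗τ | ⟦substTerm⟧ σ v σ≗τ = ⇔-refl
  Sat-substFormula σ `⊥       σ≗τ = ⇔-refl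
  Sat-substFormula σ (φ `∧ ψ) σ≗τ = Sat-substFormula σ φ σ≗τ ×-⇔ Sat-substFormula σ ψ σ≗τ
  Sat-substFormula σ (φ `∨ ψ) σ≗τ = Sat-substFormula σ φ σ≗τ ⊎-⇔ Sat-substFormula σ ψ σ≗τ
  Sat-substFormula σ (φ `⇒ ψ) σ≗τ = →-cong-⇔ (Sat-substFormula σ φ σ≗τ) (Sat-substFormula σ ψ σ≗τ)
  Sat-substFormula σ (`∀ φ)   σ≗τ = mk⇔
    (λ h a → to   (Sat-substFormula (liftSubst σ) φ (⟦liftSubst⟧ σ σ≗τ a)) (h a))
    (λ h a → from (Sat-substFormula (liftSubst σ) φ (⟦liftSubst⟧ σ σ≗τ a)) (h a))
  Sat-substFormula σ (`∃ φ)   σ≗τ =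
    Σ.congˡ {k = equivalence} (Sat-substFormula (liftSubst σ) φ (⟦liftSubst⟧ σ σ≗τ _))

  Sat-instantiate : (φ : Formula (suc n)) (u : Term m) (r : Fin n → Fin m)
                    {η : Env M m} {ρ : Env M n} → η ∘ r ≗ ρ →
                    Sat M (instantiate φ u r) η ⇔ Sat M φ (⟦ u ⟧ η ∷ᴱ ρ)
  Sat-instantiate φ u r η∘r≗ρ = Sat-substFormula _ φ λ where
    fz     → refl
    (fs i) → η∘r≗ρ i

  Sat-instantiate₂ : (φ : Formula (suc (suc n))) (u v : Term m) (r : Fin n → Fin m)
                     {η : Env M m} {ρ : Env M n} → η ∘ r ≗ ρ →
                     Sat M (instantiate₂ φ u v r) η ⇔ Sat M φ (⟦ u ⟧ η ∷ᴱ ⟦ v ⟧ η ∷ᴱ ρ)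
  Sat-instantiate₂ φ u v r η∘r≗ρ = Sat-substFormula _ φ λ where
    fz          → refl
    (fs fz)     → refl
    (fs (fs i)) → η∘r≗ρ i

  _≤ᴹ_ _<ᴹ_ : Carrier → Carrier → Set
  a ≤ᴹ b = Σ[ w ∈ Carrier ] a ⊕ w ≡ b
  a <ᴹ b = Σ[ w ∈ Carrier ] a ⊕ s w ≡ b

  <ᴹ⇒≤ᴹ : ∀ {a b} → a <ᴹ b → a ≤ᴹ b
  <ᴹ⇒≤ᴹ (w , a⊕sw≡b) = s w , a⊕sw≡b

  Standard : Carrier → Set
  Standard x = Σ[ j ∈ ℕ ] x ≡ ⌜ j ⌝

  pairᴹ : Carrier → Carrier → Carrier
  pairᴹ x y = ((x ⊕ y) ⊗ (x ⊕ y)) ⊕ x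

  record Representation (A : Pred ℕ 0ℓ) : Set where
    field
      arity      : ℕ
      formula    : Formula (suc arity)
      params     : Env M arity
      represents : ∀ k → A k ⇔ Sat M formula (⌜ k ⌝ ∷ᴱ params)

  representation : {A : Pred ℕ 0ℓ} → SSy M A → Representation A
  representation (X , (n , φ , ρ , X⇔φ) , A⇔X) =
    record { arity = n ; formula = φ ; params = ρ
           ; represents = λ k → ⇔-trans (A⇔X k) (X⇔φ ⌜ k ⌝) }

  module _ (em : ExcludedMiddle 0ℓ) where

    index : Carrier → ℕ
    index x with em {Standard x}
    ... | yes (j , _) = j
    ... | no _        = 0

    index-standard : ∀ {x} → Standard x → x ≡ ⌜ index x ⌝
    index-standard {x} std with em {Standard x}
    ... | yes (j , x≡j) = x≡j
    ... | no ¬std       = ⊥-elim (¬std std)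

    module UniqueChoice {n} (θ : Formula (suc (suc n))) (ρ : Env M n) where
      Unique : Carrier → Carrier → Set
      Unique x y = Sat M θ (x ∷ᴱ y ∷ᴱ ρ) × (∀ y′ → Sat M θ (x ∷ᴱ y′ ∷ᴱ ρ) → y′ ≡ y)

      Graph : Carrier → Carrier → Set
      Graph x y = Unique x y ⊎ (¬ (Σ[ y′ ∈ Carrier ] Unique x y′)) × y ≡ z

      choose : ∀ x → Dec (Σ[ y ∈ Carrier ] Unique x y) → Carrier
      choose x (yes (y , _)) = y
      choose x (no _)        = z

      t : Carrier → Carrier
      t x = choose x em

      choose-graph : ∀ x y d → (choose x d ≡ y) ⇔ Graph x y
      choose-graph x y (yes (y₀ , unique-y₀)) = mk⇔
        (λ { refl → inj₁ unique-y₀ })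
        (λ { (inj₁ (_ , unique-y)) → unique-y y₀ (proj₁ unique-y₀)
           ; (inj₂ (¬∃ , _))        → ⊥-elim (¬∃ (y₀ , unique-y₀)) })
      choose-graph x y (no ¬∃) = mk⇔
        (λ z≡y → inj₂ (¬∃ , sym z≡y))
        (λ { (inj₁ unique-y)  → ⊥-elim (¬∃ (y , unique-y))
           ; (inj₂ (_ , y≡z)) → sym y≡z })

      swap : Formula (suc (suc n)) → Formula (suc (suc (suc n)))
      swap φ = instantiate₂ φ (var (fs fz)) (var fz) (fs ∘ fs ∘ fs)

      Sat-swap : ∀ φ x y y′ → Sat M (swap φ) (y′ ∷ᴱ x ∷ᴱ y ∷ᴱ ρ) ⇔ Sat M φ (x ∷ᴱ y′ ∷ᴱ ρ)
      Sat-swap φ x y y′ = Sat-instantiate₂ φ (var (fs fz)) (var fz) (fs ∘ fs ∘ fs) (λ _ → refl)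

      unique : Formula (suc (suc n))
      unique = θ `∧ `∀ (swap θ `⇒ (var fz `= var (fs (fs fz))))

      Sat-unique : ∀ x y → Sat M unique (x ∷ᴱ y ∷ᴱ ρ) ⇔ Unique x y
      Sat-unique x y = ⇔-refl ×-⇔ mk⇔
        (λ h y′ → h y′ ∘ from (Sat-swap θ x y y′))
        (λ h y′ → h y′ ∘ to (Sat-swap θ x y y′))

      graph : Formula (suc (suc n))
      graph = unique `∨ ((`¬ `∃ (swap unique)) `∧ (var (fs fz) `= `0))

      Sat-graph : ∀ x y → Sat M graph (x ∷ᴱ y ∷ᴱ ρ) ⇔ Graph x y
      Sat-graph x y = Sat-unique x y ⊎-⇔
        (¬-cong-⇔ (Σ.congˡ {k = equivalence} (⇔-trans (Sat-swap unique x y _) (Sat-unique x _)))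
         ×-⇔ ⇔-refl)

      t-graph : ∀ x y → (t x ≡ y) ⇔ Sat M graph (x ∷ᴱ y ∷ᴱ ρ)
      t-graph x y = ⇔-trans (choose-graph x y em) (⇔-sym (Sat-graph x y))

    definable-unique-choice :
      (θ : Formula (suc (suc n))) (ρ : Env M n) →
      Σ[ t ∈ (Carrier → Carrier) ] DefinableFun M t ×
        (∀ x y → Sat M θ (x ∷ᴱ y ∷ᴱ ρ) → (∀ y′ → Sat M θ (x ∷ᴱ y′ ∷ᴱ ρ) → y′ ≡ y) → t x ≡ y)
    definable-unique-choice {n} θ ρ =
      t , (n , graph , ρ , t-graph) ,
      λ x y θxy unique-y → from (choose-graph x y em) (inj₁ (θxy , unique-y))
      where open UniqueChoice θ ρ

  module Arithmetic (pa : IsPA M) where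
    open IsPA pa

    zero-or-suc : ∀ x → x ≡ z ⊎ Σ[ w ∈ Carrier ] x ≡ s w
    zero-or-suc = ind ((var fz `= `0) `∨ `∃ (var (fs fz) `= `S (var fz))) []
                      (inj₁ refl) (λ x _ → inj₂ (x , refl))

    z-⊕ : ∀ a → z ⊕ a ≡ a
    z-⊕ = ind ((`0 `+ var fz) `= var fz) [] (⊕-z z) (λ a ih → trans (⊕-s z a) (cong s ih))

    ⊕-s-comm : ∀ a b → a ⊕ s b ≡ s a ⊕ b
    ⊕-s-comm a = ind ((var (fs fz) `+ `S (var fz)) `= (`S (var (fs fz)) `+ var fz)) (a ∷ [])
      (trans (⊕-s a z) (trans (cong s (⊕-z a)) (sym (⊕-z (s a)))))
      (λ b ih → trans (⊕-s a (s b)) (trans (cong s ih) (sym (⊕-s (s a) b))))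

    num-⊕ : ∀ a b → ⌜ a ⌝ ⊕ ⌜ b ⌝ ≡ ⌜ a + b ⌝
    num-⊕ a zero    = trans (⊕-z ⌜ a ⌝) (cong ⌜_⌝ (sym (+-identityʳ a)))
    num-⊕ a (suc b) = begin
      ⌜ a ⌝ ⊕ s ⌜ b ⌝  ≡⟨ ⊕-s ⌜ a ⌝ ⌜ b ⌝ ⟩
      s (⌜ a ⌝ ⊕ ⌜ b ⌝) ≡⟨ cong s (num-⊕ a b) ⟩
      ⌜ suc (a + b) ⌝   ≡⟨ cong ⌜_⌝ (sym (+-suc a b)) ⟩
      ⌜ a + suc b ⌝     ∎
      where open ≡-Reasoning

    num-⊗ : ∀ a b → ⌜ a ⌝ ⊗ ⌜ b ⌝ ≡ ⌜ a * b ⌝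
    num-⊗ a zero    = trans (⊗-z ⌜ a ⌝) (cong ⌜_⌝ (sym (*-zeroʳ a)))
    num-⊗ a (suc b) = begin
      ⌜ a ⌝ ⊗ s ⌜ b ⌝         ≡⟨ ⊗-s ⌜ a ⌝ ⌜ b ⌝ ⟩
      (⌜ a ⌝ ⊗ ⌜ b ⌝) ⊕ ⌜ a ⌝ ≡⟨ cong (_⊕ ⌜ a ⌝) (num-⊗ a b) ⟩
      ⌜ a * b ⌝ ⊕ ⌜ a ⌝       ≡⟨ num-⊕ (a * b) a ⟩
      ⌜ a * b + a ⌝           ≡⟨ cong ⌜_⌝ (trans (+-comm (a * b) a) (sym (*-suc a b))) ⟩
      ⌜ a * suc b ⌝           ∎
      where open ≡-Reasoning

    num-pair : ∀ a b → pairᴹ ⌜ a ⌝ ⌜ b ⌝ ≡ ⌜ pair a b ⌝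
    num-pair a b rewrite num-⊕ a b | num-⊗ (a + b) (a + b) = num-⊕ ((a + b) * (a + b)) a

    ≤ᴹ-num⇒standard : ∀ n {x} → x ≤ᴹ ⌜ n ⌝ → Σ[ j ∈ ℕ ] j ≤ n × x ≡ ⌜ j ⌝
    ≤ᴹ-num⇒standard n {x} (w , x⊕w≡n) with zero-or-suc w
    ... | inj₁ refl = n , ≤-refl , trans (sym (⊕-z x)) x⊕w≡n
    ≤ᴹ-num⇒standard zero    {x} (w , x⊕w≡n) | inj₂ (w′ , refl) =
      ⊥-elim (s≢z _ (trans (sym (⊕-s x w′)) x⊕w≡n))
    ≤ᴹ-num⇒standard (suc n) {x} (w , x⊕w≡n) | inj₂ (w′ , refl)
      with ≤ᴹ-num⇒standard n (w′ , s-inj _ _ (trans (sym (⊕-s x w′)) x⊕w≡n))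
    ... | j , j≤n , x≡j = j , m≤n⇒m≤1+n j≤n , x≡j

    num<ᴹnonstandard : ∀ {x} → ¬ Standard x → ∀ n → ⌜ n ⌝ <ᴹ x
    num<ᴹnonstandard {x} ¬std zero with zero-or-suc x
    ... | inj₁ x≡z        = ⊥-elim (¬std (0 , x≡z))
    ... | inj₂ (w , x≡sw) = w , trans (z-⊕ (s w)) (sym x≡sw)
    num<ᴹnonstandard {x} ¬std (suc n) with num<ᴹnonstandard ¬std n
    ... | w , n⊕sw≡x with zero-or-suc w
    ...   | inj₁ refl         =
      ⊥-elim (¬std (suc n , trans (sym n⊕sw≡x) (trans (⊕-s ⌜ n ⌝ z) (cong s (⊕-z ⌜ n ⌝)))))
    ...   | inj₂ (w′ , refl) = w′ , trans (sym (⊕-s-comm ⌜ n ⌝ (s w′))) n⊕sw≡x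

    module _ (em : ExcludedMiddle 0ℓ) where

      module Extension (f : ℕ → ℕ) (K : Representation (UnderGraph f)) where
        open Representation K

        Kᴹ : Carrier → Set
        Kᴹ v = Sat M formula (v ∷ᴱ params)

        Kᴹ-pair : ∀ a b → Kᴹ (pairᴹ ⌜ a ⌝ ⌜ b ⌝) ⇔ b ≤ f a
        Kᴹ-pair a b rewrite num-pair a b = ⇔-trans (⇔-sym (represents (pair a b))) (UnderGraph-pair f)

        -- Since K is closed downwards in the second coordinate, Θ ⌜ k ⌝ y pins y down to
        -- ⌜ f k ⌝: a nonstandard y would lie above f k + 1, but ⟨k , f k + 1⟩ ∉ K.
        Θ : Carrier → Carrier → Set
        Θ x y = (∀ m → m ≤ᴹ y → Kᴹ (pairᴹ x m)) × ¬ Kᴹ (pairᴹ x (s y))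

        θ : Formula (suc (suc arity))
        θ = `∀ ((var fz `≤ var (fs (fs fz))) `⇒
                instantiate formula (pairᵗ (var (fs fz)) (var fz)) (fs ∘ fs ∘ fs))
            `∧ (`¬ instantiate formula (pairᵗ (var fz) (`S (var (fs fz)))) (fs ∘ fs))

        Sat-θ : ∀ x y → Sat M θ (x ∷ᴱ y ∷ᴱ params) ⇔ Θ x y
        Sat-θ x y =
          mk⇔ (λ h m → to (K-at m) ∘ h m) (λ h m → from (K-at m) ∘ h m)
          ×-⇔ ¬-cong-⇔ (Sat-instantiate formula (pairᵗ (var fz) (`S (var (fs fz)))) (fs ∘ fs) (λ _ → refl))
          where
          K-at : ∀ m → Sat M (instantiate formula (pairᵗ (var (fs fz)) (var fz)) (fs ∘ fs ∘ fs))
                             (m ∷ᴱ x ∷ᴱ y ∷ᴱ params) ⇔ Kᴹ (pairᴹ x m)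
          K-at m = Sat-instantiate formula (pairᵗ (var (fs fz)) (var fz)) (fs ∘ fs ∘ fs) (λ _ → refl)

        Θ-bounded : ∀ k j {y} → Θ ⌜ k ⌝ y → ⌜ j ⌝ ≤ᴹ y → j ≤ f k
        Θ-bounded k j (below , _) j≤y = to (Kᴹ-pair k j) (below ⌜ j ⌝ j≤y)

        Θ-num : ∀ k → Θ ⌜ k ⌝ ⌜ f k ⌝
        Θ-num k = below , λ K-fk+1 → <-irrefl refl (to (Kᴹ-pair k (suc (f k))) K-fk+1)
          where
          below : ∀ m → m ≤ᴹ ⌜ f k ⌝ → Kᴹ (pairᴹ ⌜ k ⌝ m)
          below m m≤fk with ≤ᴹ-num⇒standard (f k) m≤fk
          ... | j , j≤fk , refl = from (Kᴹ-pair k j) j≤fk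

        Θ-unique : ∀ k y → Θ ⌜ k ⌝ y → y ≡ ⌜ f k ⌝
        Θ-unique k y Θky with em {Standard y}
        ... | no ¬std = ⊥-elim (<-irrefl refl
              (Θ-bounded k (suc (f k)) Θky (<ᴹ⇒≤ᴹ (num<ᴹnonstandard ¬std (suc (f k))))))
        ... | yes (j , refl) = cong ⌜_⌝ (≤∧≮⇒≡
              (Θ-bounded k j Θky (z , ⊕-z ⌜ j ⌝))
              (λ j<fk → proj₂ Θky (from (Kᴹ-pair k (suc j)) j<fk)))

        extension : Σ[ t ∈ (Carrier → Carrier) ] DefinableFun M t × (∀ k → t ⌜ k ⌝ ≡ ⌜ f k ⌝)
        extension with definable-unique-choice em θ params
        ... | t , t-definable , t-spec = t , t-definable , λ k →
          t-spec ⌜ k ⌝ ⌜ f k ⌝ (from (Sat-θ _ _) (Θ-num k)) (λ y → Θ-unique k y ∘ to (Sat-θ _ _))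

      definable-extension : SSy≡Pω M → (f : ℕ → ℕ) →
        Σ[ t ∈ (Carrier → Carrier) ] DefinableFun M t × (∀ k → t ⌜ k ⌝ ≡ ⌜ f k ⌝)
      definable-extension ssy f = Extension.extension f (representation (ssy (UnderGraph f)))

      ≤RK⇒≤RK[M] : SSy≡Pω M → {𝒰 𝒱 : Pred (Pred ℕ 0ℓ) 0ℓ} → IsUltrafilter 𝒱 →
                   𝒰 ≤RK 𝒱 → 𝒰 ≤RK[ M ] 𝒱
      ≤RK⇒≤RK[M] ssy U𝒱 (f , f-RK) with definable-extension ssy f
      ... | t , t-definable , t-extends-f = t , t-definable , λ X _ X∩ω∈𝒰 →
        up U𝒱 _ _ (λ k → subst X (sym (t-extends-f k))) (f-RK (_∩ω M X) X∩ω∈𝒰)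

      module StandardValues {𝒰 𝒱 : Pred (Pred ℕ 0ℓ) 0ℓ} (U𝒰 : IsUltrafilter 𝒰) (U𝒱 : IsUltrafilter 𝒱)
        (t : Carrier → Carrier)
        (t-RK : (X : Pred Carrier 0ℓ) → Definable M X → 𝒰 (_∩ω M X) → 𝒱 (_∩ω M (X ∘ t)))
        (S : Representation (λ k → ¬ Standard (t ⌜ k ⌝))) where
        open Representation S

        Sᴹ : Carrier → Set
        Sᴹ y = Sat M formula (y ∷ᴱ params)

        -- Every numeral is unreached, whereas for k ∈ S the nonstandard value t ⌜ k ⌝
        -- lies above ⌜ k ⌝ and so is reached from it.
        Unreached : Pred Carrier 0ℓ
        Unreached x = ¬ (Σ[ y ∈ Carrier ] Sᴹ y × t y ≡ x × y <ᴹ x)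

        Unreached-definable : DefinableFun M t → Definable M Unreached
        Unreached-definable (nt , ψt , ρt , t-graph) = arity + nt , φ , params ++ ρt , λ x →
          ¬-cong-⇔ (Σ.congˡ {k = equivalence}
            (⇔-sym (Sat-instantiate formula (var fz) r-S (lookup-++ˡ params ρt))
             ×-⇔ ⇔-trans (t-graph _ x)
                   (⇔-sym (Sat-instantiate₂ ψt (var fz) (var (fs fz)) r-t (lookup-++ʳ params ρt)))
             ×-⇔ ⇔-refl))
          where
          r-S : Fin arity → Fin (suc (suc (arity + nt)))
          r-S = fs ∘ fs ∘ (_↑ˡ nt)
          r-t : Fin nt → Fin (suc (suc (arity + nt)))
          r-t = fs ∘ fs ∘ (arity ↑ʳ_)
          φ : Formula (suc (arity + nt))
          φ = `¬ `∃ (instantiate formula (var fz) r-S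
                     `∧ (instantiate₂ ψt (var fz) (var (fs fz)) r-t `∧ (var fz `< var (fs fz))))

        num-unreached : ∀ n → Unreached ⌜ n ⌝
        num-unreached n (y , Sy , ty≡n , y<n) with ≤ᴹ-num⇒standard n (<ᴹ⇒≤ᴹ y<n)
        ... | j , _ , refl = from (represents j) Sy (n , ty≡n)

        nonstandard-values-rare : DefinableFun M t → ¬ 𝒱 (λ k → ¬ Standard (t ⌜ k ⌝))
        nonstandard-values-rare t-definable nonstandard∈𝒱 = proper U𝒱 (up U𝒱 _ _ reached
          (inter U𝒱 _ _ nonstandard∈𝒱 (t-RK Unreached (Unreached-definable t-definable)
            (up U𝒰 _ _ (λ k _ → num-unreached k) (full U𝒰)))))
          where
          reached : ∀ k → ¬ Standard (t ⌜ k ⌝) × Unreached (t ⌜ k ⌝) → ⊥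
          reached k (¬std , unreached) =
            unreached (⌜ k ⌝ , to (represents k) ¬std , refl , num<ᴹnonstandard ¬std k)

      ≤RK[M]⇒≤RK : SSy≡Pω M → {𝒰 𝒱 : Pred (Pred ℕ 0ℓ) 0ℓ} →
                   IsUltrafilter 𝒰 → IsUltrafilter 𝒱 → 𝒰 ≤RK[ M ] 𝒱 → 𝒰 ≤RK 𝒱
      ≤RK[M]⇒≤RK ssy {𝒰} {𝒱} U𝒰 U𝒱 (t , t-definable , t-RK) = index em ∘ t ∘ ⌜_⌝ , f-RK
        where
        standard-values : 𝒱 (λ k → Standard (t ⌜ k ⌝))
        standard-values with ultra U𝒱 (λ k → Standard (t ⌜ k ⌝))
        ... | inj₁ standard∈𝒱    = standard∈𝒱
        ... | inj₂ nonstandard∈𝒱 = ⊥-elim (StandardValues.nonstandard-values-rare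
              U𝒰 U𝒱 t t-RK (representation (ssy _)) t-definable nonstandard∈𝒱)

        f-RK : (A : Pred ℕ 0ℓ) → 𝒰 A → 𝒱 (λ k → A (index em (t ⌜ k ⌝)))
        f-RK A A∈𝒰 with ssy A
        ... | X , X-definable , A⇔X = up U𝒱 _ _
          (λ k (std , X-tk) → from (A⇔X _) (subst X (index-standard em std) X-tk))
          (inter U𝒱 _ _ standard-values (t-RK X X-definable (up U𝒰 _ _ (to ∘ A⇔X) A∈𝒰)))

corollary2p5 : ExcludedMiddle 0ℓ →
    (M : Structure) → IsPA M → Nonstandard M → SSy≡Pω M →
    (𝒰 𝒱 : Pred (Pred ℕ 0ℓ) 0ℓ) → IsUltrafilter 𝒰 → IsUltrafilter 𝒱 →
    (𝒰 ≤RK 𝒱) ⇔ (𝒰 ≤RK[ M ] 𝒱)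
corollary2p5 em M pa _ ssy 𝒰 𝒱 U𝒰 U𝒱 =
  mk⇔ (≤RK⇒≤RK[M] em ssy U𝒱) (≤RK[M]⇒≤RK em ssy U𝒰 U𝒱)
  where open Model.Arithmetic M pa
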